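{- Let $\pi=(d_1,\dots,d_n)$ be a graphic sequence, $r+1\leq n$, and let $G$ be a realization of $\pi$ with vertices $v_1,\dots,v_n$ where $d_G(v_i)=d_i$ for all $i$. If the subgraph $G[v_1,\dots,v_{r+1}]$ of $G$ induced by $\{v_1,\dots,v_{r+1}\}$ has at most $\binom{r+1}{2}-1$ edges, then there is a realization $H$ of $\pi$ on vertices $v_1,\dots,v_n$ such that $d_H(v_i)=d_i$ for $i=1,\dots,r+1$ and $v_rv_{r+1}\notin E(H)$.
   Context: A sequence $\pi=(d_1,\dots,d_n)$ of nonnegative integers with $d_1\geq d_2\geq\cdots\geq d_n$ is graphic if it is the degree sequence of a simple graph on $n$ vertices, called a realization of $\pi$. -}

module Defs where

open import Data.Nat using (ℕ; zero; suc; _+_; _≤_; _<_; _≥_; _<ᵇ_)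
open import Data.Bool using (Bool; true; false; _∧_)
open import Data.Fin using (Fin; toℕ)
open import Data.List using (List; []; _∷_)
open import Data.List.Base using (allFin)
open import Data.Product using (Σ; _×_; _,_)
open import Relation.Binary.PropositionalEquality using (_≡_)
open import Relation.Nullary using (¬_)
open import Relation.Nullary.Decidable using (Dec)
open import Data.Bool using (T)
open import Function.Bundles using (_↔_; Inverse)

-- A finite simple graph on vertex set Fin n (vertex i is v_{i+1}):
-- a Boolean adjacency relation that is symmetric and irreflexive.
record Graph (n : ℕ) : Set where
  field
    adj   : Fin n → Fin n → Bool
    sym   : ∀ i j → adj i j ≡ adj j i
    irrefl : ∀ i → adj i i ≡ false

open Graph public

Adj : ∀ {n} → Graph n → Fin n → Fin n → Set
Adj G i j = adj G i j ≡ true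

count : {A : Set} → (A → Bool) → List A → ℕ
count p [] = 0
count p (x ∷ xs) with p x
... | true  = suc (count p xs)
... | false = count p xs

degree : ∀ {n} → Graph n → Fin n → ℕ
degree {n} G v = count (adj G v) (allFin n)

NonIncreasing : ∀ {n} → (Fin n → ℕ) → Set
NonIncreasing {n} d = ∀ (i j : Fin n) → toℕ i ≤ toℕ j → d j ≤ d i

-- G is a realization of π: the degree sequence of G is π, i.e. the
-- vertices can be labelled so that the i-th vertex has degree d_i.
Realization : ∀ {n} → (Fin n → ℕ) → Graph n → Set
Realization {n} d G = Σ (Fin n ↔ Fin n) λ σ → ∀ i → degree G (Inverse.to σ i) ≡ d i

Graphic : ∀ {n} → (Fin n → ℕ) → Set
Graphic {n} d = Σ (Graph n) λ G → Realization d G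

inducedEdges : ∀ {n} → Graph n → ℕ → ℕ
inducedEdges {n} G m = go (allFin n)
  where
  below : Fin n → Bool
  below i = toℕ i <ᵇ m
  pairCount : Fin n → ℕ
  pairCount i with below i
  ... | false = 0
  ... | true  = count (λ j → (below j ∧ (toℕ i <ᵇ toℕ j)) ∧ adj G i j) (allFin n)
  go : List (Fin n) → ℕ
  go [] = 0
  go (x ∷ xs) = pairCount x + go xs

-- Some pair v_i v_j with i < j ≤ r+1 is a non-edge, for otherwise G[v_1, …, v_{r+1}] would
-- have all binom(r+1, 2) edges. A non-edge xy can be moved to xz whenever d(z) ≤ d(y)
-- without changing any degree: if xz is an edge, then y has a neighbour w ≠ z that is not
-- adjacent to z (otherwise d(y) < d(z), as x is a neighbour of z but not of y), and the
-- 2-switch replacing xz, yw by xy, zw makes xz a non-edge. Since π is non-increasing, two such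
-- moves, first to v_i v_{r+1} and then to v_r v_{r+1}, give H.
module Submission where

open import Defs hiding (sym)
open import Data.Nat using (ℕ; zero; suc; _+_; _∸_; _≤_; _<_; _<ᵇ_; z≤n; s≤s; s≤s⁻¹; >-nonZero)
open import Data.Nat.Properties
  using ( +-0-commutativeMonoid; ≤-refl; ≤-trans; <-≤-trans; <-irrefl; <⇒≱; m≤m+n
        ; +-mono-≤; +-mono-<-≤; +-mono-≤-<; suc-injective; m≤pred[n]⇒suc[m]≤n
        ; <ᵇ⇒<; _<?_; module ≤-Reasoning)
open import Data.Nat.Combinatorics using (_C_; nC1≡n; nCk+nC[k+1]≡[n+1]C[k+1])
open import Algebra.Properties.CommutativeMonoid.Sum +-0-commutativeMonoid
  using (sum; sum-syntax; sum-cong-≗; sum-permute; sum-replicate-zero)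
import Data.Bool as Bool
open import Data.Bool using (Bool; true; false; not; _∧_; _∨_; _xor_; if_then_else_)
open import Data.Bool.Properties
  using (∧-comm; ∨-comm; ∨-identityʳ; ∨-zeroʳ; not-involutive; xor-comm; true-xor; xor-identityʳ; T-≡)
open import Data.Fin using (Fin; zero; suc; toℕ; _≟_)
open import Data.Fin.Properties using (any?; <⇒≢)
open import Data.Fin.Permutation as Perm using (Permutation; _⟨$⟩ʳ_)
open import Data.Fin.Permutation.Components using (transpose)
open import Data.List using (List; _∷_; tabulate)
open import Data.List.Base using (allFin)
open import Data.Product using (Σ; ∃; ∃₂; _×_; _,_)
open import Data.Sum using (_⊎_; inj₁; inj₂)
open import Function using (id; _∘_)
open import Function.Bundles using (Equivalence)
open import Function.Construct.Identity using (↔-id)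
open import Relation.Binary.PropositionalEquality
  using (_≡_; _≢_; _≗_; refl; sym; trans; cong; cong₂; subst; subst₂; ≢-sym; module ≡-Reasoning)
open import Relation.Nullary using (¬_; yes; no; does; contradiction)
open import Relation.Nullary.Decidable using (dec-true; dec-false; _×-dec_; ¬?)

private
  variable
    n : ℕ

⟦_⟧ : Bool → ℕ
⟦ true ⟧ = 1
⟦ false ⟧ = 0

⟦⟧-mono : ∀ {a b} → (a ≡ true → b ≡ true) → ⟦ a ⟧ ≤ ⟦ b ⟧
⟦⟧-mono {false} _ = z≤n
⟦⟧-mono {true} a⇒b rewrite a⇒b refl = ≤-refl

∑-mono-≤ : {f g : Fin n → ℕ} → (∀ i → f i ≤ g i) → sum f ≤ sum g
∑-mono-≤ {zero} f≤g = z≤n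
∑-mono-≤ {suc n} f≤g = +-mono-≤ (f≤g zero) (∑-mono-≤ (f≤g ∘ suc))

∑-mono-< : {f g : Fin n → ℕ} → (∀ i → f i ≤ g i) → (k : Fin n) → f k < g k → sum f < sum g
∑-mono-< f≤g zero fk<gk = +-mono-<-≤ fk<gk (∑-mono-≤ (f≤g ∘ suc))
∑-mono-< f≤g (suc k) fk<gk = +-mono-≤-< (f≤g zero) (∑-mono-< (f≤g ∘ suc) k fk<gk)

count-tabulate : ∀ {A : Set} n (p : A → Bool) (f : Fin n → A) → count p (tabulate f) ≡ ∑[ i < n ] ⟦ p (f i) ⟧
count-tabulate zero p f = refl
count-tabulate (suc n) p f with p (f zero)
... | true = cong suc (count-tabulate n p (f ∘ suc))
... | false = count-tabulate n p (f ∘ suc)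

NonIncreasing-resp-≗ : {f g : Fin n → ℕ} → f ≗ g → NonIncreasing f → NonIncreasing g
NonIncreasing-resp-≗ f≗g f↓ i j i≤j = subst₂ _≤_ (f≗g j) (f≗g i) (f↓ i j i≤j)

Adj⇒≢ : (G : Graph n) {u v : Fin n} → Adj G u v → u ≢ v
Adj⇒≢ G {u} u~v refl with () ← trans (sym (irrefl G u)) u~v

degree≡∑ : (G : Graph n) (v : Fin n) → degree G v ≡ ∑[ k < n ] ⟦ adj G v k ⟧
degree≡∑ {n} G v = count-tabulate n (adj G v) id

degree≡∑-permute : (G : Graph n) (v : Fin n) (π : Permutation n n) →
  degree G v ≡ ∑[ k < n ] ⟦ adj G v (π ⟨$⟩ʳ k) ⟧
degree≡∑-permute G v π = trans (degree≡∑ G v) (sum-permute (⟦_⟧ ∘ adj G v) π)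

degree-permute : (G H : Graph n) {u v : Fin n} (π : Permutation n n) →
  adj H u ≗ adj G v ∘ (π ⟨$⟩ʳ_) → degree H u ≡ degree G v
degree-permute G H {u} {v} π row =
  trans (degree≡∑ H u) (trans (sum-cong-≗ (cong ⟦_⟧ ∘ row)) (sym (degree≡∑-permute G v π)))

transpose-other : {i j k : Fin n} → k ≢ i → k ≢ j → transpose i j k ≡ k
transpose-other {i = i} {j} {k} k≢i k≢j rewrite dec-false (k ≟ i) k≢i | dec-false (k ≟ j) k≢j = refl

⁅_,_⁆ : Fin n → Fin n → Fin n → Bool
⁅ a , b ⁆ k = does (k ≟ a) ∨ does (k ≟ b)

⁅⁆-left : (a b : Fin n) → ⁅ a , b ⁆ a ≡ true
⁅⁆-left a b rewrite dec-true (a ≟ a) refl = refl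

⁅⁆-right : (a b : Fin n) → ⁅ a , b ⁆ b ≡ true
⁅⁆-right a b rewrite dec-true (b ≟ b) refl = ∨-zeroʳ _

⁅⁆-other : {a b k : Fin n} → k ≢ a → k ≢ b → ⁅ a , b ⁆ k ≡ false
⁅⁆-other {a = a} {b} {k} k≢a k≢b rewrite dec-false (k ≟ a) k≢a | dec-false (k ≟ b) k≢b = refl

⁅⁆-sound : {a b k : Fin n} → ⁅ a , b ⁆ k ≡ true → k ≡ a ⊎ k ≡ b
⁅⁆-sound {a = a} {b} {k} k∈ with k ≟ a | k ≟ b
... | yes k≡a | _ = inj₁ k≡a
... | no _ | yes k≡b = inj₂ k≡b

xor-true : ∀ b → b xor true ≡ not b
xor-true b = trans (xor-comm b true) (true-xor b)

xor⁅⁆≗∘transpose : (f : Fin n → Bool) {p q : Fin n} → f p ≡ not (f q) →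
  (λ k → f k xor ⁅ p , q ⁆ k) ≗ f ∘ transpose p q
xor⁅⁆≗∘transpose f {p} {q} fp≡¬fq k with k ≟ p | k ≟ q
... | yes refl | _ = trans (xor-true (f k)) (trans (cong not fp≡¬fq) (not-involutive (f q)))
... | no k≢p | yes refl rewrite dec-true (k ≟ k) refl = trans (xor-true (f k)) (sym fp≡¬fq)
... | no k≢p | no k≢q rewrite dec-false (k ≟ q) k≢q = xor-identityʳ (f k)

crossing : (A B : Fin n → Bool) → Fin n → Fin n → Bool
crossing A B u v = (A u ∧ B v) ∨ (B u ∧ A v)

crossing-sym : (A B : Fin n → Bool) (u v : Fin n) → crossing A B u v ≡ crossing A B v u
crossing-sym A B u v =
  trans (∨-comm (A u ∧ B v) (B u ∧ A v)) (cong₂ _∨_ (∧-comm (B u) (A v)) (∧-comm (A u) (B v)))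

crossing-fromA : (A B : Fin n → Bool) (u : Fin n) → A u ≡ true → B u ≡ false → crossing A B u ≗ B
crossing-fromA A B u u∈A u∉B v rewrite u∈A | u∉B = ∨-identityʳ (B v)

crossing-fromB : (A B : Fin n → Bool) (u : Fin n) → B u ≡ true → A u ≡ false → crossing A B u ≗ A
crossing-fromB A B u u∈B u∉A v rewrite u∉A | u∈B = refl

crossing-outside : (A B : Fin n → Bool) (u : Fin n) → A u ≡ false → B u ≡ false → crossing A B u ≗ λ _ → false
crossing-outside A B u u∉A u∉B v rewrite u∉A | u∉B = refl

Disjoint : (A B : Fin n → Bool) → Set
Disjoint A B = ∀ k → A k ∧ B k ≡ false

toggleAcross : (G : Graph n) (A B : Fin n → Bool) → Disjoint A B → Graph n
toggleAcross G A B A∩B=∅ = record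
  { adj    = λ u v → adj G u v xor crossing A B u v
  ; sym    = λ u v → cong₂ _xor_ (Graph.sym G u v) (crossing-sym A B u v)
  ; irrefl = λ u → cong₂ _xor_ (irrefl G u) (cong₂ _∨_ (A∩B=∅ u) (trans (∧-comm (B u) (A u)) (A∩B=∅ u)))
  }

degree-toggleAcross-swap : (G : Graph n) (A B : Fin n → Bool) (A∩B=∅ : Disjoint A B) {u p q : Fin n} →
  crossing A B u ≗ ⁅ p , q ⁆ → adj G u p ≡ not (adj G u q) → degree (toggleAcross G A B A∩B=∅) u ≡ degree G u
degree-toggleAcross-swap G A B A∩B=∅ {u} {p} {q} toggled differ =
  degree-permute G (toggleAcross G A B A∩B=∅) (Perm.transpose p q)
    (λ k → trans (cong (adj G u k xor_) (toggled k)) (xor⁅⁆≗∘transpose (adj G u) differ k))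

degree-toggleAcross-outside : (G : Graph n) (A B : Fin n → Bool) (A∩B=∅ : Disjoint A B) {u : Fin n} →
  A u ≡ false → B u ≡ false → degree (toggleAcross G A B A∩B=∅) u ≡ degree G u
degree-toggleAcross-outside G A B A∩B=∅ {u} u∉A u∉B = degree-permute G (toggleAcross G A B A∩B=∅) Perm.id
  (λ k → trans (cong (adj G u k xor_) (crossing-outside A B u u∉A u∉B k)) (xor-identityʳ (adj G u k)))

-- The 2-switch toggles the 4-cycle x z w y, i.e. all pairs between {x, w} and {y, z}. In the
-- row of each of these four vertices it exchanges a neighbour with a non-neighbour, so the
-- row is permuted by a transposition.
twoSwitch : (G : Graph n) {x y z w : Fin n} → x ≢ y → w ≢ z →
  Adj G x z → Adj G y w → adj G x y ≡ false → adj G z w ≡ false →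
  Σ (Graph n) λ H → degree H ≗ degree G × adj H x z ≡ false
twoSwitch G {x} {y} {z} {w} x≢y w≢z x~z y~w x≁y z≁w =
  H , degree-preserved , cong₂ _xor_ x~z (trans (crossing-fromA A B x x∈A x∉B z) (⁅⁆-right y z))
  where
  A B : Fin _ → Bool
  A = ⁅ x , w ⁆
  B = ⁅ y , z ⁆
  w~y : Adj G w y
  w~y = trans (Graph.sym G w y) y~w
  w≁z : adj G w z ≡ false
  w≁z = trans (Graph.sym G w z) z≁w
  y≁x : adj G y x ≡ false
  y≁x = trans (Graph.sym G y x) x≁y
  z~x : Adj G z x
  z~x = trans (Graph.sym G z x) x~z
  x∈A : A x ≡ true
  x∈A = ⁅⁆-left x w
  x∉B : B x ≡ false
  x∉B = ⁅⁆-other x≢y (Adj⇒≢ G x~z)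
  A∩B=∅ : Disjoint A B
  A∩B=∅ k with A k in k∈A
  ... | false = refl
  ... | true with ⁅⁆-sound {a = x} {w} {k} k∈A
  ...   | inj₁ refl = x∉B
  ...   | inj₂ refl = ⁅⁆-other (Adj⇒≢ G w~y) w≢z
  H : Graph _
  H = toggleAcross G A B A∩B=∅
  swapsRow : ∀ {u p q} → crossing A B u ≗ ⁅ p , q ⁆ → adj G u p ≡ not (adj G u q) → degree H u ≡ degree G u
  swapsRow = degree-toggleAcross-swap G A B A∩B=∅
  degree-preserved : degree H ≗ degree G
  degree-preserved u = classify u (A u) (B u) refl refl
    where
    classify : ∀ u a b → A u ≡ a → B u ≡ b → degree H u ≡ degree G u
    classify u true true u∈A u∈B with () ← trans (sym (cong₂ _∧_ u∈A u∈B)) (A∩B=∅ u)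
    classify u true false u∈A u∉B with ⁅⁆-sound {a = x} {w} {u} u∈A
    ... | inj₁ refl = swapsRow (crossing-fromA A B u u∈A u∉B) (trans x≁y (cong not (sym x~z)))
    ... | inj₂ refl = swapsRow (crossing-fromA A B u u∈A u∉B) (trans w~y (cong not (sym w≁z)))
    classify u false true u∉A u∈B with ⁅⁆-sound {a = y} {z} {u} u∈B
    ... | inj₁ refl = swapsRow (crossing-fromB A B u u∈B u∉A) (trans y≁x (cong not (sym y~w)))
    ... | inj₂ refl = swapsRow (crossing-fromB A B u u∈B u∉A) (trans z~x (cong not (sym z≁w)))
    classify u false false u∉A u∉B = degree-toggleAcross-outside G A B A∩B=∅ u∉A u∉B

-- If there is no such w, the row of y lies pointwise below the row of z with y and z
-- exchanged, strictly at x; hence degree G y < degree G z.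
switchPartner : (G : Graph n) {x y z : Fin n} → x ≢ y → Adj G x z → adj G x y ≡ false →
  degree G z ≤ degree G y → ∃ λ w → w ≢ z × Adj G y w × adj G z w ≡ false
switchPartner {n} G {x} {y} {z} x≢y x~z x≁y dz≤dy
  with any? (λ w → ¬? (w ≟ z) ×-dec (adj G y w Bool.≟ true) ×-dec (adj G z w Bool.≟ false))
... | yes partner = partner
... | no noPartner = contradiction dz≤dy (<⇒≱ dy<dz)
  where
  covered : ∀ {k} → k ≢ z → Adj G y k → Adj G z k
  covered {k} k≢z y~k with adj G z k in adj-zk
  ... | true = refl
  ... | false = contradiction (k , k≢z , y~k , adj-zk) noPartner
  dominated : ∀ k → Adj G y k → Adj G z (transpose y z k)
  dominated k y~k with k ≟ y | k ≟ z
  ... | yes refl | _ with () ← trans (sym y~k) (irrefl G k)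
  ... | no k≢y | yes refl rewrite dec-true (k ≟ k) refl = trans (Graph.sym G k y) y~k
  ... | no k≢y | no k≢z rewrite dec-false (k ≟ z) k≢z = covered k≢z y~k
  gained : ⟦ adj G y x ⟧ < ⟦ adj G z (transpose y z x) ⟧
  gained rewrite transpose-other x≢y (Adj⇒≢ G x~z) | Graph.sym G y x | x≁y | Graph.sym G z x | x~z = s≤s z≤n
  dy<dz : degree G y < degree G z
  dy<dz = begin-strict
    degree G y                                 ≡⟨ degree≡∑ G y ⟩
    ∑[ k < n ] ⟦ adj G y k ⟧                   <⟨ ∑-mono-< (λ k → ⟦⟧-mono (dominated k)) x gained ⟩
    ∑[ k < n ] ⟦ adj G z (transpose y z k) ⟧   ≡⟨ degree≡∑-permute G z (Perm.transpose y z) ⟨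
    degree G z                                 ∎
    where open ≤-Reasoning

moveNonEdge : (G : Graph n) {x y z : Fin n} → x ≢ y → adj G x y ≡ false → degree G z ≤ degree G y →
  Σ (Graph n) λ H → degree H ≗ degree G × adj H x z ≡ false
moveNonEdge G {x} {y} {z} x≢y x≁y dz≤dy with adj G x z in adj-xz
... | false = G , (λ _ → refl) , adj-xz
... | true with switchPartner G x≢y adj-xz x≁y dz≤dy
...   | w , w≢z , y~w , z≁w = twoSwitch G x≢y w≢z adj-xz y~w x≁y z≁w

moveNonEdgeToTop : (G : Graph n) → NonIncreasing (degree G) → {i j a b : Fin n} →
  toℕ i < toℕ j → toℕ j ≤ toℕ b → suc (toℕ a) ≡ toℕ b → adj G i j ≡ false →
  Σ (Graph n) λ H → degree H ≗ degree G × adj H b a ≡ false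
moveNonEdgeToTop G ordered {i} {j} {a} {b} i<j j≤b a+1≡b i≁j
  with moveNonEdge G (<⇒≢ i<j) i≁j (ordered j b j≤b)
... | G₁ , deg₁ , i≁₁b
  with moveNonEdge G₁ (≢-sym (<⇒≢ (<-≤-trans i<j j≤b))) (trans (Graph.sym G₁ b i) i≁₁b)
         (NonIncreasing-resp-≗ (sym ∘ deg₁) ordered i a i≤a)
  where
  i≤a : toℕ i ≤ toℕ a
  i≤a = s≤s⁻¹ (≤-trans i<j (subst (toℕ j ≤_) (sym a+1≡b) j≤b))
... | G₂ , deg₂ , b≁₂a = G₂ , (λ v → trans (deg₂ v) (deg₁ v)) , b≁₂a

CompleteBelow : Graph n → ℕ → Set
CompleteBelow {n} G m = ∀ (i j : Fin n) → toℕ i < toℕ j → toℕ j < m → Adj G i j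

forwardEdges : Graph n → ℕ → Fin n → ℕ
forwardEdges {n} G m i = if toℕ i <ᵇ m then ∑[ j < n ] ⟦ ((toℕ j <ᵇ m) ∧ (toℕ i <ᵇ toℕ j)) ∧ adj G i j ⟧ else 0

-- inducedEdges sums rows with functions local to its where-block, which cannot be named;
-- the metavariable sumRows is solved by unification to the local summation function.
inducedEdges≡∑ : (G : Graph n) (m : ℕ) → inducedEdges G m ≡ ∑[ i < n ] forwardEdges G m i
inducedEdges≡∑ {n} G m = trans unfold (sumRows-tabulate id)
  where
  sumRows : List (Fin n) → ℕ
  sumRows = _
  unfold : inducedEdges G m ≡ sumRows (allFin n)
  unfold with allFin n
  ... | is = refl
  sumRows-∷ : ∀ i is → sumRows (i ∷ is) ≡ forwardEdges G m i + sumRows is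
  sumRows-∷ i is with toℕ i <ᵇ m
  ... | false = refl
  ... | true = cong (_+ sumRows is) (count-tabulate n _ id)
  sumRows-tabulate : ∀ {k} (f : Fin k → Fin n) → sumRows (tabulate f) ≡ ∑[ i < k ] forwardEdges G m (f i)
  sumRows-tabulate {zero} f = refl
  sumRows-tabulate {suc k} f =
    trans (sumRows-∷ (f zero) (tabulate (f ∘ suc))) (cong (forwardEdges G m (f zero) +_) (sumRows-tabulate (f ∘ suc)))

∑-below : ∀ {m} → m ≤ n → (g : ℕ → ℕ) → ∑[ i < n ] (if toℕ i <ᵇ m then g (toℕ i) else 0) ≡ ∑[ i < m ] g (toℕ i)
∑-below {n} {zero} _ g = sum-replicate-zero n
∑-below {suc n} {suc m} (s≤s m≤n) g = cong (g 0 +_) (∑-below m≤n (g ∘ suc))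

∑-ones : ∀ m → ∑[ _ < m ] 1 ≡ m
∑-ones zero = refl
∑-ones (suc m) = cong suc (∑-ones m)

[1+m]C2≡m+mC2 : ∀ m → suc m C 2 ≡ m + m C 2
[1+m]C2≡m+mC2 m = trans (sym (nCk+nC[k+1]≡[n+1]C[k+1] m 1)) (cong (_+ m C 2) (nC1≡n m))

∑∑<ᵇ≡C2 : ∀ m → ∑[ i < m ] ∑[ j < m ] ⟦ toℕ i <ᵇ toℕ j ⟧ ≡ m C 2
∑∑<ᵇ≡C2 zero = refl
∑∑<ᵇ≡C2 (suc m) = trans (cong₂ _+_ (∑-ones m) (∑∑<ᵇ≡C2 m)) (sym ([1+m]C2≡m+mC2 m))

<ᵇ≡true⇒< : ∀ {a b} → (a <ᵇ b) ≡ true → a < b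
<ᵇ≡true⇒< {a} {b} a<b = <ᵇ⇒< a b (Equivalence.from T-≡ a<b)

inducedEdges-complete : (G : Graph n) {m : ℕ} → m ≤ n → CompleteBelow G m → inducedEdges G m ≡ m C 2
inducedEdges-complete {n} G {m} m≤n complete = begin
  inducedEdges G m
    ≡⟨ inducedEdges≡∑ G m ⟩
  ∑[ i < n ] forwardEdges G m i
    ≡⟨ sum-cong-≗ (λ i → cong (λ s → if toℕ i <ᵇ m then s else 0) (sum-cong-≗ (entry≡ i))) ⟩
  ∑[ i < n ] (if toℕ i <ᵇ m then ∑[ j < n ] (if toℕ j <ᵇ m then ⟦ toℕ i <ᵇ toℕ j ⟧ else 0) else 0)
    ≡⟨ ∑-below m≤n (λ k → ∑[ j < n ] (if toℕ j <ᵇ m then ⟦ k <ᵇ toℕ j ⟧ else 0)) ⟩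
  ∑[ i < m ] ∑[ j < n ] (if toℕ j <ᵇ m then ⟦ toℕ i <ᵇ toℕ j ⟧ else 0)
    ≡⟨ sum-cong-≗ {m} (λ i → ∑-below m≤n (λ k → ⟦ toℕ i <ᵇ k ⟧)) ⟩
  ∑[ i < m ] ∑[ j < m ] ⟦ toℕ i <ᵇ toℕ j ⟧
    ≡⟨ ∑∑<ᵇ≡C2 m ⟩
  m C 2 ∎
  where
  open ≡-Reasoning
  entry≡ : ∀ i j → ⟦ ((toℕ j <ᵇ m) ∧ (toℕ i <ᵇ toℕ j)) ∧ adj G i j ⟧ ≡ (if toℕ j <ᵇ m then ⟦ toℕ i <ᵇ toℕ j ⟧ else 0)
  entry≡ i j with toℕ j <ᵇ m in j<m | toℕ i <ᵇ toℕ j in i<j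
  ... | false | _ = refl
  ... | true | false = refl
  ... | true | true = cong ⟦_⟧ (complete i j (<ᵇ≡true⇒< i<j) (<ᵇ≡true⇒< j<m))

nonEdgeBelow : (G : Graph n) {m : ℕ} → m ≤ n → inducedEdges G m < m C 2 →
  ∃₂ λ i j → toℕ i < toℕ j × toℕ j < m × adj G i j ≡ false
nonEdgeBelow G {m} m≤n fewEdges
  with any? (λ i → any? (λ j → (toℕ i <? toℕ j) ×-dec (toℕ j <? m) ×-dec (adj G i j Bool.≟ false)))
... | yes nonEdge = nonEdge
... | no noNonEdge = contradiction fewEdges (<-irrefl (inducedEdges-complete G m≤n complete))
  where
  complete : CompleteBelow G m
  complete i j i<j j<m with adj G i j in adj-ij
  ... | true = refl
  ... | false = contradiction (i , j , i<j , j<m , adj-ij) noNonEdge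

[1+r]C2-positive : ∀ {r} → 1 ≤ r → 0 < suc r C 2
[1+r]C2-positive {r} 1≤r = <-≤-trans 1≤r (subst (r ≤_) (sym ([1+m]C2≡m+mC2 r)) (m≤m+n r (r C 2)))

lemma2p3 : (n : ℕ) (d : Fin n → ℕ) → NonIncreasing d → Graphic d →
    (r : ℕ) → 1 ≤ r → suc r ≤ n →
    (G : Graph n) → (∀ i → degree G i ≡ d i) →
    inducedEdges G (suc r) ≤ (suc r C 2) ∸ 1 →
    (vr vr+1 : Fin n) → suc (toℕ vr) ≡ r → suc (toℕ vr+1) ≡ suc r →
    Σ (Graph n) λ H → Realization d H
      × (∀ i → toℕ i < suc r → degree H i ≡ d i)
      × ¬ Adj H vr vr+1
lemma2p3 n d d↓ _ r 1≤r r<n G degG fewEdges a b a+1≡r b+1≡r+1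
  with nonEdgeBelow G r<n (m≤pred[n]⇒suc[m]≤n {{>-nonZero ([1+r]C2-positive 1≤r)}} fewEdges)
... | i , j , i<j , j<r+1 , i≁j
  with moveNonEdgeToTop G (NonIncreasing-resp-≗ (sym ∘ degG) d↓) i<j
         (subst (toℕ j ≤_) (sym b≡r) (s≤s⁻¹ j<r+1)) (trans a+1≡r (sym b≡r)) i≁j
  where
  b≡r : toℕ b ≡ r
  b≡r = suc-injective b+1≡r+1
... | H , degH , b≁a = H , (↔-id (Fin n) , degH≗d) , (λ k _ → degH≗d k) , a≁b
  where
  degH≗d : degree H ≗ d
  degH≗d v = trans (degH v) (degG v)
  a≁b : ¬ Adj H a b
  a≁b a~b with () ← trans (sym b≁a) (trans (Graph.sym H b a) a~b)
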